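{- For every extended LTL formula $\varphi$ containing no $\mathbf{GF}$ or $\mathbf{FG}$ operator, each of $\mathbf{GF}\varphi$ and $\mathbf{FG}\varphi$ is equivalent to a formula in normal form with at most $3^{|\varphi|}\cdot|\varphi|$ nodes.
   Context: Extended LTL formulas over a finite set $Ap$: $\varphi::=\mathbf{tt}\mid\mathbf{ff}\mid a\mid\overline a\mid\varphi\wedge\varphi\mid\varphi\vee\varphi\mid\mathbf X\varphi\mid\varphi\mathbf U\varphi\mid\varphi\mathbf W\varphi\mid\mathbf{GF}\varphi\mid\mathbf{FG}\varphi$, on infinite words over $2^{Ap}$ with standard semantics ($w_i$ suffix from $i$; $\varphi\mathbf U\psi$: $\exists k.\,w_k\models\psi\wedge\forall j<k.\,w_j\models\varphi$; $\varphi\mathbf W\psi$: $\forall k.\,w_k\models\varphi$ or $\varphi\mathbf U\psi$; $\mathbf{GF}\varphi$: $w_i\models\varphi$ for infinitely many $i$; $\mathbf{FG}\varphi$: for all but finitely many $i$). $|\varphi|$ = number of nodes of the syntax tree. Nodes are classified by top operator; temporal nodes: $\mathbf U,\mathbf W,\mathbf X,\mathbf{GF},\mathbf{FG}$; limit nodes: $\mathbf{GF},\mathbf{FG}$; "under" means proper descendant. Normal form: (1) no $\mathbf U$-node under a $\mathbf W$-node; (2) no limit node under another temporal node; (3) no $\mathbf W$-node under a $\mathbf{GF}$-node and no $\mathbf U$-node under an $\mathbf{FG}$-node. -}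

module Defs where

open import Data.Nat using (ℕ; zero; suc; _+_; _*_; _^_; _≤_; _<_)
open import Data.Fin using (Fin)
open import Data.Bool using (Bool; true; false; _∨_)
open import Data.Product using (Σ; _×_)
open import Data.Sum using (_⊎_)
open import Data.Unit using (⊤)
open import Data.Empty using (⊥)
open import Relation.Binary.PropositionalEquality using (_≡_)

data LTL (n : ℕ) : Set where
  tt ff : LTL n
  atom natom : Fin n → LTL n
  _∧ₗ_ _∨ₗ_ : LTL n → LTL n → LTL n
  𝐗 : LTL n → LTL n
  _𝐔_ _𝐖_ : LTL n → LTL n → LTL n
  𝐆𝐅 𝐅𝐆 : LTL n → LTL n

size : ∀ {n} → LTL n → ℕ
size tt = 1
size ff = 1
size (atom a) = 1
size (natom a) = 1
size (φ ∧ₗ ψ) = suc (size φ + size ψ)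
size (φ ∨ₗ ψ) = suc (size φ + size ψ)
size (𝐗 φ) = suc (size φ)
size (φ 𝐔 ψ) = suc (size φ + size ψ)
size (φ 𝐖 ψ) = suc (size φ + size ψ)
size (𝐆𝐅 φ) = suc (size φ)
size (𝐅𝐆 φ) = suc (size φ)

hasU : ∀ {n} → LTL n → Bool
hasU (φ ∧ₗ ψ) = hasU φ ∨ hasU ψ
hasU (φ ∨ₗ ψ) = hasU φ ∨ hasU ψ
hasU (𝐗 φ) = hasU φ
hasU (φ 𝐔 ψ) = true
hasU (φ 𝐖 ψ) = hasU φ ∨ hasU ψ
hasU (𝐆𝐅 φ) = hasU φ
hasU (𝐅𝐆 φ) = hasU φ
hasU _ = false

hasW : ∀ {n} → LTL n → Bool
hasW (φ ∧ₗ ψ) = hasW φ ∨ hasW ψ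
hasW (φ ∨ₗ ψ) = hasW φ ∨ hasW ψ
hasW (𝐗 φ) = hasW φ
hasW (φ 𝐔 ψ) = hasW φ ∨ hasW ψ
hasW (φ 𝐖 ψ) = true
hasW (𝐆𝐅 φ) = hasW φ
hasW (𝐅𝐆 φ) = hasW φ
hasW _ = false

hasLimit : ∀ {n} → LTL n → Bool
hasLimit (φ ∧ₗ ψ) = hasLimit φ ∨ hasLimit ψ
hasLimit (φ ∨ₗ ψ) = hasLimit φ ∨ hasLimit ψ
hasLimit (𝐗 φ) = hasLimit φ
hasLimit (φ 𝐔 ψ) = hasLimit φ ∨ hasLimit ψ
hasLimit (φ 𝐖 ψ) = hasLimit φ ∨ hasLimit ψ
hasLimit (𝐆𝐅 φ) = true
hasLimit (𝐅𝐆 φ) = true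
hasLimit _ = false

-- Normal form: at every node, the constraints on its proper descendants:
-- (1) no U under W; (2) no limit node under a temporal node;
-- (3) no W under GF, no U under FG.
NormalForm : ∀ {n} → LTL n → Set
NormalForm tt = ⊤
NormalForm ff = ⊤
NormalForm (atom a) = ⊤
NormalForm (natom a) = ⊤
NormalForm (φ ∧ₗ ψ) = NormalForm φ × NormalForm ψ
NormalForm (φ ∨ₗ ψ) = NormalForm φ × NormalForm ψ
NormalForm (𝐗 φ) = NormalForm φ × hasLimit φ ≡ false
NormalForm (φ 𝐔 ψ) = NormalForm φ × NormalForm ψ
                   × hasLimit φ ≡ false × hasLimit ψ ≡ false
NormalForm (φ 𝐖 ψ) = NormalForm φ × NormalForm ψ
                   × hasLimit φ ≡ false × hasLimit ψ ≡ false
                   × hasU φ ≡ false × hasU ψ ≡ false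
NormalForm (𝐆𝐅 φ) = NormalForm φ × hasLimit φ ≡ false × hasW φ ≡ false
NormalForm (𝐅𝐆 φ) = NormalForm φ × hasLimit φ ≡ false × hasU φ ≡ false

Letter : ℕ → Set
Letter n = Fin n → Bool

Word : ℕ → Set
Word n = ℕ → Letter n

suffix : ∀ {n} → Word n → ℕ → Word n
suffix w i j = w (i + j)

_⊨_ : ∀ {n} → Word n → LTL n → Set
w ⊨ tt = ⊤
w ⊨ ff = ⊥
w ⊨ atom a = w 0 a ≡ true
w ⊨ natom a = w 0 a ≡ false
w ⊨ (φ ∧ₗ ψ) = (w ⊨ φ) × (w ⊨ ψ)
w ⊨ (φ ∨ₗ ψ) = (w ⊨ φ) ⊎ (w ⊨ ψ)
w ⊨ 𝐗 φ = suffix w 1 ⊨ φ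
w ⊨ (φ 𝐔 ψ) = Σ ℕ λ k → (suffix w k ⊨ ψ) × (∀ j → j < k → suffix w j ⊨ φ)
w ⊨ (φ 𝐖 ψ) = (∀ k → suffix w k ⊨ φ)
             ⊎ (Σ ℕ λ k → (suffix w k ⊨ ψ) × (∀ j → j < k → suffix w j ⊨ φ))
w ⊨ 𝐆𝐅 φ = ∀ m → Σ ℕ λ i → m ≤ i × (suffix w i ⊨ φ)
w ⊨ 𝐅𝐆 φ = Σ ℕ λ m → ∀ i → m ≤ i → suffix w i ⊨ φ

_≣_ : ∀ {n} → LTL n → LTL n → Set
φ ≣ ψ = ∀ w → ((w ⊨ φ) → (w ⊨ ψ)) × ((w ⊨ ψ) → (w ⊨ φ))

HasSmallNF : ∀ {n} → LTL n → ℕ → Set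
HasSmallNF χ bound = Σ (LTL _) λ ψ → NormalForm ψ × size ψ ≤ bound × (ψ ≣ χ)

{-# OPTIONS --safe #-}
module Submission where

open import Defs
open import Data.Nat using (ℕ; zero; suc; _+_; _*_; _^_; _≤_; _⊔_; _∸_; z≤n; s≤s; >-nonZero)
open import Data.Nat.Properties
open import Data.Nat.Tactic.RingSolver using (solve-∀)
open import Data.Bool using (Bool; false; _∨_)
open import Data.Product using (Σ; _×_; _,_; proj₁; proj₂)
open import Data.Sum using (_⊎_; inj₁; inj₂)
open import Data.Unit using () renaming (tt to ⋆)
open import Data.Empty using (⊥-elim)
open import Function using (_∘_)
open import Level using (0ℓ)
open import Axiom.ExcludedMiddle using (ExcludedMiddle)
open import Relation.Nullary using (¬_; yes; no)
open import Relation.Binary.PropositionalEquality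
  using (_≡_; _≗_; refl; sym; trans; cong; cong₂; cong-app)

-- A limit operator L ∈ {𝐆𝐅, 𝐅𝐆} only sees what holds from some point on, so L χ implies
-- L φ as soon as χ eventually entails φ along the word. Push L through φ bottom-up,
-- maintaining a case split: a disjunction of guarded formulas L χ such that in every
-- enabled case χ eventually entails φ, and in some enabled case φ eventually entails χ.
-- The Boolean connectives, 𝐗 and the until operator that L preserves (𝐔 under 𝐆𝐅, 𝐖 under
-- 𝐅𝐆) are congruences for eventual entailment, so case splits combine by products; the
-- other one is removed by
--   𝐆𝐅 (φ 𝐖 ψ) ≡ 𝐅𝐆 φ ∨ 𝐆𝐅 (φ 𝐔 ψ)   and   𝐅𝐆 (φ 𝐔 ψ) ≡ 𝐆𝐅 ψ ∧ 𝐅𝐆 (φ 𝐖 ψ),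
-- whose new limit formulas become guards, in normal form by induction (excluded middle
-- decides which case is enabled). The leaves χ are then free of 𝐖 (resp. 𝐔), so the split
-- is in normal form; it has at most 3^|φ| cases, of total size at most 3^|φ|·|φ|.

private variable
  n i k m : ℕ
  φ ψ χ a b c a₁ a₂ b₁ b₂ c₁ c₂ : LTL n
  v v′ w : Word n

∨-false⁻ : {x y : Bool} → (x ∨ y) ≡ false → x ≡ false × y ≡ false
∨-false⁻ {false} y≡false = refl , y≡false

∨-false² : {x₁ y₁ x₂ y₂ : Bool} → x₁ ≡ false × y₁ ≡ false → x₂ ≡ false × y₂ ≡ false
         → (x₁ ∨ x₂) ≡ false × (y₁ ∨ y₂) ≡ false
∨-false² (refl , refl) (refl , refl) = refl , refl

data LimitFree {n : ℕ} : LTL n → Set where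
  tt : LimitFree tt
  ff : LimitFree ff
  atom : ∀ p → LimitFree (atom p)
  natom : ∀ p → LimitFree (natom p)
  _∧ₗ_ : LimitFree φ → LimitFree ψ → LimitFree (φ ∧ₗ ψ)
  _∨ₗ_ : LimitFree φ → LimitFree ψ → LimitFree (φ ∨ₗ ψ)
  𝐗 : LimitFree φ → LimitFree (𝐗 φ)
  _𝐔_ : LimitFree φ → LimitFree ψ → LimitFree (φ 𝐔 ψ)
  _𝐖_ : LimitFree φ → LimitFree ψ → LimitFree (φ 𝐖 ψ)

limitFree : ∀ (φ : LTL n) → hasLimit φ ≡ false → LimitFree φ
limitFree tt _ = tt
limitFree ff _ = ff
limitFree (atom p) _ = atom p
limitFree (natom p) _ = natom p
limitFree (φ ∧ₗ ψ) h = let (h₁ , h₂) = ∨-false⁻ h in limitFree φ h₁ ∧ₗ limitFree ψ h₂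
limitFree (φ ∨ₗ ψ) h = let (h₁ , h₂) = ∨-false⁻ h in limitFree φ h₁ ∨ₗ limitFree ψ h₂
limitFree (𝐗 φ) h = 𝐗 (limitFree φ h)
limitFree (φ 𝐔 ψ) h = let (h₁ , h₂) = ∨-false⁻ h in limitFree φ h₁ 𝐔 limitFree ψ h₂
limitFree (φ 𝐖 ψ) h = let (h₁ , h₂) = ∨-false⁻ h in limitFree φ h₁ 𝐖 limitFree ψ h₂

-- Eventual entailment

⊨-resp-≗ : ∀ (φ : LTL n) → v ≗ v′ → v ⊨ φ → v′ ⊨ φ
⊨-resp-≗ tt _ x = x
⊨-resp-≗ ff _ ()
⊨-resp-≗ (atom p) e x = trans (sym (cong-app (e 0) p)) x
⊨-resp-≗ (natom p) e x = trans (sym (cong-app (e 0) p)) x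
⊨-resp-≗ (φ ∧ₗ ψ) e (x , y) = ⊨-resp-≗ φ e x , ⊨-resp-≗ ψ e y
⊨-resp-≗ (φ ∨ₗ ψ) e (inj₁ x) = inj₁ (⊨-resp-≗ φ e x)
⊨-resp-≗ (φ ∨ₗ ψ) e (inj₂ y) = inj₂ (⊨-resp-≗ ψ e y)
⊨-resp-≗ (𝐗 φ) e x = ⊨-resp-≗ φ (e ∘ suc) x
⊨-resp-≗ (φ 𝐔 ψ) e (k , x , y) =
  k , ⊨-resp-≗ ψ (e ∘ (k +_)) x , λ j j<k → ⊨-resp-≗ φ (e ∘ (j +_)) (y j j<k)
⊨-resp-≗ (φ 𝐖 ψ) e (inj₁ always) = inj₁ λ k → ⊨-resp-≗ φ (e ∘ (k +_)) (always k)
⊨-resp-≗ (φ 𝐖 ψ) e (inj₂ u) = inj₂ (⊨-resp-≗ (φ 𝐔 ψ) e u)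
⊨-resp-≗ (𝐆𝐅 φ) e gf m with gf m
... | i , m≤i , x = i , m≤i , ⊨-resp-≗ φ (e ∘ (i +_)) x
⊨-resp-≗ (𝐅𝐆 φ) e (m , fg) = m , λ i m≤i → ⊨-resp-≗ φ (e ∘ (i +_)) (fg i m≤i)

suffix-suffix : v ≗ suffix w i → ∀ k → suffix v k ≗ suffix w (i + k)
suffix-suffix {w = w} {i} e k j = trans (e (k + j)) (cong w (sym (+-assoc i k j)))

suffix-∸ : v ≗ suffix w i → i ≤ k → suffix v (k ∸ i) ≗ suffix w k
suffix-∸ {w = w} {i = i} {k = k} e i≤k j =
  trans (suffix-suffix {w = w} {i = i} e (k ∸ i) j) (cong (λ l → w (l + j)) (m+[n∸m]≡n i≤k))

-- Entailment is required of all words pointwise equal to the suffix, since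
-- suffix (suffix w i) k and suffix w (i + k) agree only pointwise.
record Entails (w : Word n) (m : ℕ) (a b : LTL n) : Set where
  constructor entailing
  field
    entails : ∀ i → m ≤ i → ∀ v → v ≗ suffix w i → v ⊨ a → v ⊨ b

infix 4 _⊨_⇛_

record _⊨_⇛_ (w : Word n) (a b : LTL n) : Set where
  constructor eventually
  field
    {start} : ℕ
    entails-from-start : Entails w start a b

Entails-suffix : Entails w m a b → m ≤ i → v ≗ suffix w i
               → ∀ k → suffix v k ⊨ a → suffix v k ⊨ b
Entails-suffix {w = w} {i = i} (entailing f) m≤i e k =
  f (i + k) (m≤n⇒m≤n+o k m≤i) _ (suffix-suffix {w = w} e k)

⇛-everywhere : (∀ {v} i → v ≗ suffix w i → v ⊨ a → v ⊨ b) → w ⊨ a ⇛ b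
⇛-everywhere f = eventually {start = 0} (entailing λ i _ _ → f i)

⇛-refl : w ⊨ a ⇛ a
⇛-refl = ⇛-everywhere λ _ _ x → x

⇛-trans : w ⊨ a ⇛ b → w ⊨ b ⇛ c → w ⊨ a ⇛ c
⇛-trans (eventually {m} (entailing f)) (eventually {k} (entailing g)) =
  eventually (entailing λ i le v e →
    g i (m⊔n≤o⇒n≤o m k le) v e ∘ f i (m⊔n≤o⇒m≤o m k le) v e)

⇛-lift₂ : (∀ {m} → Entails w m a₁ b₁ → Entails w m a₂ b₂ → Entails w m c₁ c₂)
        → w ⊨ a₁ ⇛ b₁ → w ⊨ a₂ ⇛ b₂ → w ⊨ c₁ ⇛ c₂
⇛-lift₂ h (eventually {m} (entailing f)) (eventually {k} (entailing g)) =
  eventually (h (entailing λ i → f i ∘ m⊔n≤o⇒m≤o m k) (entailing λ i → g i ∘ m⊔n≤o⇒n≤o m k))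

Congruent : (LTL n → LTL n → LTL n) → Set
Congruent {n} op = ∀ {w : Word n} {a₁ b₁ a₂ b₂}
                  → w ⊨ a₁ ⇛ b₁ → w ⊨ a₂ ⇛ b₂ → w ⊨ op a₁ a₂ ⇛ op b₁ b₂

⇛-∧ : Congruent {n} _∧ₗ_
⇛-∧ = ⇛-lift₂ λ (entailing f) (entailing g) →
  entailing λ i le v e (x , y) → f i le v e x , g i le v e y

⇛-∨ : Congruent {n} _∨ₗ_
⇛-∨ = ⇛-lift₂ λ (entailing f) (entailing g) → entailing λ where
  i le v e (inj₁ x) → inj₁ (f i le v e x)
  i le v e (inj₂ y) → inj₂ (g i le v e y)

Entails-𝐔 : Entails w m a₁ b₁ → Entails w m a₂ b₂ → Entails w m (a₁ 𝐔 a₂) (b₁ 𝐔 b₂)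
Entails-𝐔 f g = entailing λ i le v e (k , x , y) →
  k , Entails-suffix g le e k x , λ j j<k → Entails-suffix f le e j (y j j<k)

⇛-𝐔 : Congruent {n} _𝐔_
⇛-𝐔 = ⇛-lift₂ Entails-𝐔

⇛-𝐖 : Congruent {n} _𝐖_
⇛-𝐖 = ⇛-lift₂ λ f g → entailing λ where
  i le v e (inj₁ always) → inj₁ λ k → Entails-suffix f le e k (always k)
  i le v e (inj₂ u) → inj₂ (Entails.entails (Entails-𝐔 f g) i le v e u)

⇛-𝐗 : w ⊨ a ⇛ b → w ⊨ 𝐗 a ⇛ 𝐗 b
⇛-𝐗 (eventually f) = eventually (entailing λ i le v e → Entails-suffix f le e 1)

ff-⇛ : w ⊨ ff ⇛ a
ff-⇛ = ⇛-everywhere λ _ _ ()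

⇛-tt : w ⊨ a ⇛ tt
⇛-tt = ⇛-everywhere λ _ _ _ → ⋆

𝐔-⇛-𝐖 : w ⊨ a 𝐔 b ⇛ a 𝐖 b
𝐔-⇛-𝐖 = ⇛-everywhere λ _ _ → inj₂

𝐖-⇛-𝐔-if-¬𝐅𝐆 : ¬ (w ⊨ 𝐅𝐆 a) → w ⊨ a 𝐖 b ⇛ a 𝐔 b
𝐖-⇛-𝐔-if-¬𝐅𝐆 {w = w} {a = a} ¬fg = ⇛-everywhere λ where
  i e (inj₁ always) →
    ⊥-elim (¬fg (i , λ k i≤k → ⊨-resp-≗ a (suffix-∸ {w = w} e i≤k) (always (k ∸ i))))
  i e (inj₂ u) → u

𝐖-⇛-𝐔-if-𝐆𝐅 : w ⊨ 𝐆𝐅 b → w ⊨ a 𝐖 b ⇛ a 𝐔 b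
𝐖-⇛-𝐔-if-𝐆𝐅 {w = w} {b = b} gf = ⇛-everywhere λ where
  i e (inj₁ always) → let (k , i≤k , x) = gf i in
    k ∸ i , ⊨-resp-≗ b (sym ∘ suffix-∸ {w = w} e i≤k) x , λ j _ → always j
  i e (inj₂ u) → u

tt-⇛-𝐖-if-𝐅𝐆 : w ⊨ 𝐅𝐆 a → w ⊨ tt ⇛ a 𝐖 b
tt-⇛-𝐖-if-𝐅𝐆 {w = w} {a = a} (m , fg) = eventually (entailing λ i m≤i v e _ →
  inj₁ λ k →
    ⊨-resp-≗ a (sym ∘ suffix-suffix {w = w} {i = i} e k) (fg (i + k) (m≤n⇒m≤n+o k m≤i)))

Monotone : (LTL n → LTL n) → Word n → Set
Monotone L w = ∀ {a b} → w ⊨ a ⇛ b → w ⊨ L a → w ⊨ L b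

𝐆𝐅-mono : Monotone 𝐆𝐅 w
𝐆𝐅-mono {w = w} (eventually {m} (entailing f)) gf k =
  let (i , le , x) = gf (m ⊔ k) in
  i , m⊔n≤o⇒n≤o m k le , f i (m⊔n≤o⇒m≤o m k le) (suffix w i) (λ _ → refl) x

𝐅𝐆-mono : Monotone 𝐅𝐆 w
𝐅𝐆-mono {w = w} (eventually {m} (entailing f)) (k , fg) =
  m ⊔ k , λ i le →
    f i (m⊔n≤o⇒m≤o m k le) (suffix w i) (λ _ → refl) (fg i (m⊔n≤o⇒n≤o m k le))

-- Case splits

data Cases (n : ℕ) : Set where
  leaf : LTL n → Cases n
  guard : LTL n → Cases n → Cases n
  fork : Cases n → Cases n → Cases n

private variable
  T T₁ T₂ U : Cases n

flatten : (LTL n → LTL n) → Cases n → LTL n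
flatten L (leaf χ) = L χ
flatten L (guard c T) = c ∧ₗ flatten L T
flatten L (fork T U) = flatten L T ∨ₗ flatten L U

mapLeaves : (LTL n → LTL n) → Cases n → Cases n
mapLeaves g (leaf χ) = leaf (g χ)
mapLeaves g (guard c T) = guard c (mapLeaves g T)
mapLeaves g (fork T U) = fork (mapLeaves g T) (mapLeaves g U)

combine : (LTL n → LTL n → LTL n) → Cases n → Cases n → Cases n
combine op (leaf χ) T₂ = mapLeaves (op χ) T₂
combine op (guard c T) T₂ = guard c (combine op T T₂)
combine op (fork T U) T₂ = fork (combine op T T₂) (combine op U T₂)

Sound : Cases n → LTL n → Word n → Set
Sound (leaf χ) φ w = w ⊨ χ ⇛ φ
Sound (guard c T) φ w = w ⊨ c → Sound T φ w
Sound (fork T U) φ w = Sound T φ w × Sound U φ w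

Complete : Cases n → LTL n → Word n → Set
Complete (leaf χ) φ w = w ⊨ φ ⇛ χ
Complete (guard c T) φ w = (w ⊨ c) × Complete T φ w
Complete (fork T U) φ w = Complete T φ w ⊎ Complete U φ w

Correct : Cases n → LTL n → Set
Correct {n} T φ = (w : Word n) → Sound T φ w × Complete T φ w

sound-mapLeaves : ∀ {g} T → (∀ {χ} → w ⊨ χ ⇛ φ → w ⊨ g χ ⇛ ψ)
                → Sound T φ w → Sound (mapLeaves g T) ψ w
sound-mapLeaves (leaf χ) h s = h s
sound-mapLeaves (guard c T) h s = sound-mapLeaves T h ∘ s
sound-mapLeaves (fork T U) h (s , t) = sound-mapLeaves T h s , sound-mapLeaves U h t

complete-mapLeaves : ∀ {g} T → (∀ {χ} → w ⊨ φ ⇛ χ → w ⊨ ψ ⇛ g χ)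
                   → Complete T φ w → Complete (mapLeaves g T) ψ w
complete-mapLeaves (leaf χ) h s = h s
complete-mapLeaves (guard c T) h (x , s) = x , complete-mapLeaves T h s
complete-mapLeaves (fork T U) h (inj₁ s) = inj₁ (complete-mapLeaves T h s)
complete-mapLeaves (fork T U) h (inj₂ s) = inj₂ (complete-mapLeaves U h s)

sound-combine : ∀ {op ρ} T₁ T₂ → (∀ {χ₁ χ₂} → w ⊨ χ₁ ⇛ φ → w ⊨ χ₂ ⇛ ψ → w ⊨ op χ₁ χ₂ ⇛ ρ)
              → Sound T₁ φ w → Sound T₂ ψ w → Sound (combine op T₁ T₂) ρ w
sound-combine (leaf χ) T₂ h s₁ s₂ = sound-mapLeaves T₂ (h s₁) s₂
sound-combine (guard c T) T₂ h s₁ s₂ x = sound-combine T T₂ h (s₁ x) s₂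
sound-combine (fork T U) T₂ h (s , t) s₂ =
  sound-combine T T₂ h s s₂ , sound-combine U T₂ h t s₂

complete-combine : ∀ {op ρ} T₁ T₂ → (∀ {χ₁ χ₂} → w ⊨ φ ⇛ χ₁ → w ⊨ ψ ⇛ χ₂ → w ⊨ ρ ⇛ op χ₁ χ₂)
                 → Complete T₁ φ w → Complete T₂ ψ w → Complete (combine op T₁ T₂) ρ w
complete-combine (leaf χ) T₂ h s₁ s₂ = complete-mapLeaves T₂ (h s₁) s₂
complete-combine (guard c T) T₂ h (x , s₁) s₂ = x , complete-combine T T₂ h s₁ s₂
complete-combine (fork T U) T₂ h (inj₁ s) s₂ = inj₁ (complete-combine T T₂ h s s₂)
complete-combine (fork T U) T₂ h (inj₂ s) s₂ = inj₂ (complete-combine U T₂ h s s₂)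

correct-leaf : Correct (leaf φ) φ
correct-leaf _ = ⇛-refl , ⇛-refl

correct-𝐗 : Correct T φ → Correct (mapLeaves 𝐗 T) (𝐗 φ)
correct-𝐗 {T = T} c w =
  sound-mapLeaves T ⇛-𝐗 (proj₁ (c w)) , complete-mapLeaves T ⇛-𝐗 (proj₂ (c w))

correct-combine : ∀ {op} → Congruent op
                → Correct T₁ φ → Correct T₂ ψ → Correct (combine op T₁ T₂) (op φ ψ)
correct-combine {T₁ = T₁} {T₂ = T₂} cong-op c₁ c₂ w =
  sound-combine T₁ T₂ cong-op (proj₁ (c₁ w)) (proj₁ (c₂ w)) ,
  complete-combine T₁ T₂ cong-op (proj₂ (c₁ w)) (proj₂ (c₂ w))

flatten-sound : ∀ {L} T → Monotone L w → Sound T φ w → w ⊨ flatten L T → w ⊨ L φ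
flatten-sound (leaf χ) mono s x = mono s x
flatten-sound (guard c T) mono s (x , y) = flatten-sound T mono (s x) y
flatten-sound (fork T U) mono (s , t) (inj₁ x) = flatten-sound T mono s x
flatten-sound (fork T U) mono (s , t) (inj₂ y) = flatten-sound U mono t y

flatten-complete : ∀ {L} T → Monotone L w → Complete T φ w → w ⊨ L φ → w ⊨ flatten L T
flatten-complete (leaf χ) mono s x = mono s x
flatten-complete (guard c T) mono (y , s) x = y , flatten-complete T mono s x
flatten-complete (fork T U) mono (inj₁ s) x = inj₁ (flatten-complete T mono s x)
flatten-complete (fork T U) mono (inj₂ s) x = inj₂ (flatten-complete U mono s x)

flatten-≣ : ∀ {L} T → (∀ {w} → Monotone L w) → Correct T φ → flatten L T ≣ L φ
flatten-≣ T mono c w =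
  flatten-sound T mono (proj₁ (c w)) , flatten-complete T mono (proj₂ (c w))

-- The leaf ff is the case ¬ 𝐆𝐅 ψ, where φ 𝐔 ψ eventually fails. The catch-all clauses
-- are meant for atomic formulas only: limit nodes are excluded by LimitFree.
casesGF casesFG : LTL n → Cases n
casesGF (φ ∧ₗ ψ) = combine _∧ₗ_ (casesGF φ) (casesGF ψ)
casesGF (φ ∨ₗ ψ) = combine _∨ₗ_ (casesGF φ) (casesGF ψ)
casesGF (𝐗 φ) = mapLeaves 𝐗 (casesGF φ)
casesGF (φ 𝐔 ψ) = combine _𝐔_ (casesGF φ) (casesGF ψ)
casesGF (φ 𝐖 ψ) =
  fork (guard (flatten 𝐅𝐆 (casesFG φ)) (leaf tt)) (combine _𝐔_ (casesGF φ) (casesGF ψ))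
casesGF φ = leaf φ
casesFG (φ ∧ₗ ψ) = combine _∧ₗ_ (casesFG φ) (casesFG ψ)
casesFG (φ ∨ₗ ψ) = combine _∨ₗ_ (casesFG φ) (casesFG ψ)
casesFG (𝐗 φ) = mapLeaves 𝐗 (casesFG φ)
casesFG (φ 𝐔 ψ) =
  fork (leaf ff) (guard (flatten 𝐆𝐅 (casesGF ψ)) (combine _𝐖_ (casesFG φ) (casesFG ψ)))
casesFG (φ 𝐖 ψ) = combine _𝐖_ (casesFG φ) (casesFG ψ)
casesFG φ = leaf φ

HoldsAfter : Word n → LTL n → ℕ → Set
HoldsAfter w b m = Σ ℕ λ i → m ≤ i × (suffix w i ⊨ b)

module _ (em : ExcludedMiddle 0ℓ) where

  ¬𝐆𝐅⇒eventually-never : ¬ (w ⊨ 𝐆𝐅 b) → Σ ℕ λ m → ¬ (HoldsAfter w b m)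
  ¬𝐆𝐅⇒eventually-never {w = w} {b = b} ¬gf with em {Σ ℕ λ m → ¬ (HoldsAfter w b m)}
  ... | yes never = never
  ... | no ¬never = ⊥-elim (¬gf later)
    where
    later : ∀ m → HoldsAfter w b m
    later m with em {HoldsAfter w b m}
    ... | yes l = l
    ... | no ¬l = ⊥-elim (¬never (m , ¬l))

  𝐔-⇛-ff-if-¬𝐆𝐅 : ¬ (w ⊨ 𝐆𝐅 b) → w ⊨ a 𝐔 b ⇛ ff
  𝐔-⇛-ff-if-¬𝐆𝐅 {w = w} {b = b} ¬gf =
    let (m , never) = ¬𝐆𝐅⇒eventually-never {w = w} {b = b} ¬gf in
    eventually (entailing λ i m≤i v e (k , x , _) →
      never (i + k , m≤n⇒m≤n+o k m≤i , ⊨-resp-≗ b (suffix-suffix {w = w} e k) x))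

  casesGF-correct : LimitFree φ → Correct (casesGF φ) φ
  casesFG-correct : LimitFree φ → Correct (casesFG φ) φ

  casesGF-correct tt = correct-leaf
  casesGF-correct ff = correct-leaf
  casesGF-correct (atom p) = correct-leaf
  casesGF-correct (natom p) = correct-leaf
  casesGF-correct (p ∧ₗ q) = correct-combine ⇛-∧ (casesGF-correct p) (casesGF-correct q)
  casesGF-correct (p ∨ₗ q) = correct-combine ⇛-∨ (casesGF-correct p) (casesGF-correct q)
  casesGF-correct (𝐗 p) = correct-𝐗 (casesGF-correct p)
  casesGF-correct (p 𝐔 q) = correct-combine ⇛-𝐔 (casesGF-correct p) (casesGF-correct q)
  casesGF-correct {φ = φ 𝐖 ψ} (p 𝐖 q) w = (sound-𝐅𝐆 , sound-𝐔) , complete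
    where
    gf-φ = casesGF-correct p w
    gf-ψ = casesGF-correct q w
    fg-φ = casesFG-correct p w

    sound-𝐅𝐆 : w ⊨ flatten 𝐅𝐆 (casesFG φ) → w ⊨ tt ⇛ φ 𝐖 ψ
    sound-𝐅𝐆 = tt-⇛-𝐖-if-𝐅𝐆 ∘ flatten-sound (casesFG φ) 𝐅𝐆-mono (proj₁ fg-φ)

    sound-𝐔 : Sound (combine _𝐔_ (casesGF φ) (casesGF ψ)) (φ 𝐖 ψ) w
    sound-𝐔 = sound-combine (casesGF φ) (casesGF ψ) (λ s t → ⇛-trans (⇛-𝐔 s t) 𝐔-⇛-𝐖)
                (proj₁ gf-φ) (proj₁ gf-ψ)

    complete : Complete (casesGF (φ 𝐖 ψ)) (φ 𝐖 ψ) w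
    complete with em {w ⊨ 𝐅𝐆 φ}
    ... | yes fg = inj₁ (flatten-complete (casesFG φ) 𝐅𝐆-mono (proj₂ fg-φ) fg , ⇛-tt)
    ... | no ¬fg = inj₂ (complete-combine (casesGF φ) (casesGF ψ)
                          (λ s t → ⇛-trans (𝐖-⇛-𝐔-if-¬𝐅𝐆 ¬fg) (⇛-𝐔 s t))
                          (proj₂ gf-φ) (proj₂ gf-ψ))

  casesFG-correct tt = correct-leaf
  casesFG-correct ff = correct-leaf
  casesFG-correct (atom p) = correct-leaf
  casesFG-correct (natom p) = correct-leaf
  casesFG-correct (p ∧ₗ q) = correct-combine ⇛-∧ (casesFG-correct p) (casesFG-correct q)
  casesFG-correct (p ∨ₗ q) = correct-combine ⇛-∨ (casesFG-correct p) (casesFG-correct q)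
  casesFG-correct (𝐗 p) = correct-𝐗 (casesFG-correct p)
  casesFG-correct (p 𝐖 q) = correct-combine ⇛-𝐖 (casesFG-correct p) (casesFG-correct q)
  casesFG-correct {φ = φ 𝐔 ψ} (p 𝐔 q) w = (ff-⇛ , sound-𝐖) , complete
    where
    fg-φ = casesFG-correct p w
    fg-ψ = casesFG-correct q w
    gf-ψ = casesGF-correct q w

    sound-𝐖 : w ⊨ flatten 𝐆𝐅 (casesGF ψ) → Sound (combine _𝐖_ (casesFG φ) (casesFG ψ)) (φ 𝐔 ψ) w
    sound-𝐖 g = sound-combine (casesFG φ) (casesFG ψ) (λ s t → ⇛-trans (⇛-𝐖 s t) (𝐖-⇛-𝐔-if-𝐆𝐅 gf))
                  (proj₁ fg-φ) (proj₁ fg-ψ)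
      where gf = flatten-sound (casesGF ψ) 𝐆𝐅-mono (proj₁ gf-ψ) g

    complete : Complete (casesFG (φ 𝐔 ψ)) (φ 𝐔 ψ) w
    complete with em {w ⊨ 𝐆𝐅 ψ}
    ... | yes gf = inj₂ (flatten-complete (casesGF ψ) 𝐆𝐅-mono (proj₂ gf-ψ) gf ,
                         complete-combine (casesFG φ) (casesFG ψ)
                           (λ s t → ⇛-trans 𝐔-⇛-𝐖 (⇛-𝐖 s t)) (proj₂ fg-φ) (proj₂ fg-ψ))
    ... | no ¬gf = inj₁ (𝐔-⇛-ff-if-¬𝐆𝐅 ¬gf)

-- Normal form

normal-if-noLimit-noW : ∀ (χ : LTL n) → hasLimit χ ≡ false → hasW χ ≡ false → NormalForm χ
normal-if-noLimit-noW tt _ _ = ⋆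
normal-if-noLimit-noW ff _ _ = ⋆
normal-if-noLimit-noW (atom p) _ _ = ⋆
normal-if-noLimit-noW (natom p) _ _ = ⋆
normal-if-noLimit-noW (φ ∧ₗ ψ) l w with ∨-false⁻ l | ∨-false⁻ w
... | l₁ , l₂ | w₁ , w₂ = normal-if-noLimit-noW φ l₁ w₁ , normal-if-noLimit-noW ψ l₂ w₂
normal-if-noLimit-noW (φ ∨ₗ ψ) l w with ∨-false⁻ l | ∨-false⁻ w
... | l₁ , l₂ | w₁ , w₂ = normal-if-noLimit-noW φ l₁ w₁ , normal-if-noLimit-noW ψ l₂ w₂
normal-if-noLimit-noW (𝐗 φ) l w = normal-if-noLimit-noW φ l w , l
normal-if-noLimit-noW (φ 𝐔 ψ) l w with ∨-false⁻ l | ∨-false⁻ w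
... | l₁ , l₂ | w₁ , w₂ =
  normal-if-noLimit-noW φ l₁ w₁ , normal-if-noLimit-noW ψ l₂ w₂ , l₁ , l₂

normal-if-noLimit-noU : ∀ (χ : LTL n) → hasLimit χ ≡ false → hasU χ ≡ false → NormalForm χ
normal-if-noLimit-noU tt _ _ = ⋆
normal-if-noLimit-noU ff _ _ = ⋆
normal-if-noLimit-noU (atom p) _ _ = ⋆
normal-if-noLimit-noU (natom p) _ _ = ⋆
normal-if-noLimit-noU (φ ∧ₗ ψ) l u with ∨-false⁻ l | ∨-false⁻ u
... | l₁ , l₂ | u₁ , u₂ = normal-if-noLimit-noU φ l₁ u₁ , normal-if-noLimit-noU ψ l₂ u₂
normal-if-noLimit-noU (φ ∨ₗ ψ) l u with ∨-false⁻ l | ∨-false⁻ u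
... | l₁ , l₂ | u₁ , u₂ = normal-if-noLimit-noU φ l₁ u₁ , normal-if-noLimit-noU ψ l₂ u₂
normal-if-noLimit-noU (𝐗 φ) l u = normal-if-noLimit-noU φ l u , l
normal-if-noLimit-noU (φ 𝐖 ψ) l u with ∨-false⁻ l | ∨-false⁻ u
... | l₁ , l₂ | u₁ , u₂ =
  normal-if-noLimit-noU φ l₁ u₁ , normal-if-noLimit-noU ψ l₂ u₂ , l₁ , l₂ , u₁ , u₂

GFLeaf FGLeaf : LTL n → Set
GFLeaf χ = hasLimit χ ≡ false × hasW χ ≡ false
FGLeaf χ = hasLimit χ ≡ false × hasU χ ≡ false

data NormalCases (P : LTL n → Set) : Cases n → Set where
  leaf : P χ → NormalCases P (leaf χ)
  guard : NormalForm c → NormalCases P T → NormalCases P (guard c T)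
  fork : NormalCases P T → NormalCases P U → NormalCases P (fork T U)

normalCases-mapLeaves : ∀ {P Q : LTL n → Set} {g} → (∀ {χ} → P χ → Q (g χ))
                      → NormalCases P T → NormalCases Q (mapLeaves g T)
normalCases-mapLeaves h (leaf x) = leaf (h x)
normalCases-mapLeaves h (guard x y) = guard x (normalCases-mapLeaves h y)
normalCases-mapLeaves h (fork x y) = fork (normalCases-mapLeaves h x) (normalCases-mapLeaves h y)

normalCases-combine : ∀ {P : LTL n → Set} {op} → (∀ {a b} → P a → P b → P (op a b))
                    → NormalCases P T₁ → NormalCases P T₂ → NormalCases P (combine op T₁ T₂)
normalCases-combine h (leaf x) y = normalCases-mapLeaves (h x) y
normalCases-combine h (guard x x′) y = guard x (normalCases-combine h x′ y)
normalCases-combine h (fork x x′) y =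
  fork (normalCases-combine h x y) (normalCases-combine h x′ y)

flatten-normal : ∀ {P : LTL n → Set} {L} → (∀ {χ} → P χ → NormalForm (L χ))
               → NormalCases P T → NormalForm (flatten L T)
flatten-normal h (leaf x) = h x
flatten-normal h (guard x y) = x , flatten-normal h y
flatten-normal h (fork x y) = flatten-normal h x , flatten-normal h y

𝐆𝐅-normal : GFLeaf χ → NormalForm (𝐆𝐅 χ)
𝐆𝐅-normal {χ = χ} (l , nw) = normal-if-noLimit-noW χ l nw , l , nw

𝐅𝐆-normal : FGLeaf χ → NormalForm (𝐅𝐆 χ)
𝐅𝐆-normal {χ = χ} (l , u) = normal-if-noLimit-noU χ l u , l , u

casesGF-normal : LimitFree φ → NormalCases GFLeaf (casesGF φ)
casesFG-normal : LimitFree φ → NormalCases FGLeaf (casesFG φ)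
casesGF-normal tt = leaf (refl , refl)
casesGF-normal ff = leaf (refl , refl)
casesGF-normal (atom p) = leaf (refl , refl)
casesGF-normal (natom p) = leaf (refl , refl)
casesGF-normal (p ∧ₗ q) = normalCases-combine ∨-false² (casesGF-normal p) (casesGF-normal q)
casesGF-normal (p ∨ₗ q) = normalCases-combine ∨-false² (casesGF-normal p) (casesGF-normal q)
casesGF-normal (𝐗 p) = normalCases-mapLeaves (λ x → x) (casesGF-normal p)
casesGF-normal (p 𝐔 q) = normalCases-combine ∨-false² (casesGF-normal p) (casesGF-normal q)
casesGF-normal (p 𝐖 q) =
  fork (guard (flatten-normal 𝐅𝐆-normal (casesFG-normal p)) (leaf (refl , refl)))
       (normalCases-combine ∨-false² (casesGF-normal p) (casesGF-normal q))
casesFG-normal tt = leaf (refl , refl)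
casesFG-normal ff = leaf (refl , refl)
casesFG-normal (atom p) = leaf (refl , refl)
casesFG-normal (natom p) = leaf (refl , refl)
casesFG-normal (p ∧ₗ q) = normalCases-combine ∨-false² (casesFG-normal p) (casesFG-normal q)
casesFG-normal (p ∨ₗ q) = normalCases-combine ∨-false² (casesFG-normal p) (casesFG-normal q)
casesFG-normal (𝐗 p) = normalCases-mapLeaves (λ x → x) (casesFG-normal p)
casesFG-normal (p 𝐖 q) = normalCases-combine ∨-false² (casesFG-normal p) (casesFG-normal q)
casesFG-normal (p 𝐔 q) =
  fork (leaf (refl , refl))
       (guard (flatten-normal 𝐆𝐅-normal (casesGF-normal q))
              (normalCases-combine ∨-false² (casesFG-normal p) (casesFG-normal q)))

-- Size

leaves flatSize : Cases n → ℕ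
leaves (leaf χ) = 1
leaves (guard c T) = leaves T
leaves (fork T U) = leaves T + leaves U
flatSize (leaf χ) = suc (size χ)
flatSize (guard c T) = suc (size c + flatSize T)
flatSize (fork T U) = suc (flatSize T + flatSize U)

size-flatten : ∀ {L} → (∀ χ → size (L χ) ≡ suc (size χ))
             → (T : Cases n) → size (flatten L T) ≡ flatSize T
size-flatten size-L (leaf χ) = size-L χ
size-flatten size-L (guard c T) = cong (λ s → suc (size c + s)) (size-flatten size-L T)
size-flatten size-L (fork T U) =
  cong₂ (λ s t → suc (s + t)) (size-flatten size-L T) (size-flatten size-L U)

leaves-pos : (T : Cases n) → 1 ≤ leaves T
leaves-pos (leaf χ) = ≤-refl
leaves-pos (guard c T) = leaves-pos T
leaves-pos (fork T U) = m≤n⇒m≤n+o (leaves U) (leaves-pos T)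

leaves-mapLeaves : ∀ g (T : Cases n) → leaves (mapLeaves g T) ≡ leaves T
leaves-mapLeaves g (leaf χ) = refl
leaves-mapLeaves g (guard c T) = leaves-mapLeaves g T
leaves-mapLeaves g (fork T U) = cong₂ _+_ (leaves-mapLeaves g T) (leaves-mapLeaves g U)

leaves-combine : ∀ op (T₁ T₂ : Cases n) → leaves (combine op T₁ T₂) ≡ leaves T₁ * leaves T₂
leaves-combine op (leaf χ) T₂ = trans (leaves-mapLeaves (op χ) T₂) (sym (+-identityʳ (leaves T₂)))
leaves-combine op (guard c T) T₂ = leaves-combine op T T₂
leaves-combine op (fork T U) T₂ =
  trans (cong₂ _+_ (leaves-combine op T T₂) (leaves-combine op U T₂))
        (sym (*-distribʳ-+ (leaves T₂) (leaves T) (leaves U)))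

flatSize-mapLeaves : ∀ {g} d → (∀ χ → size (g χ) ≡ d + size χ)
                   → (T : Cases n) → flatSize (mapLeaves g T) ≡ leaves T * d + flatSize T
flatSize-mapLeaves d size-g (leaf χ) = trans (cong suc (size-g χ)) (leaf-eq d (size χ))
  where
  leaf-eq : ∀ d s → suc (d + s) ≡ 1 * d + suc s
  leaf-eq = solve-∀
flatSize-mapLeaves d size-g (guard c T) =
  trans (cong (λ s → suc (size c + s)) (flatSize-mapLeaves d size-g T)) (guard-eq (size c) _ _)
  where
  guard-eq : ∀ c x y → suc (c + (x + y)) ≡ x + suc (c + y)
  guard-eq = solve-∀
flatSize-mapLeaves d size-g (fork T U) =
  trans (cong₂ (λ s t → suc (s + t))
               (flatSize-mapLeaves d size-g T) (flatSize-mapLeaves d size-g U))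
        (fork-eq (leaves T) (leaves U) d (flatSize T) (flatSize U))
  where
  fork-eq : ∀ l₁ l₂ d s t → suc ((l₁ * d + s) + (l₂ * d + t)) ≡ (l₁ + l₂) * d + suc (s + t)
  fork-eq = solve-∀

flatSize-combine : ∀ {op} → (∀ a b → size (op a b) ≡ suc (size a + size b)) → (T₁ T₂ : Cases n)
                 → flatSize (combine op T₁ T₂) ≤ leaves T₂ * flatSize T₁ + leaves T₁ * flatSize T₂
flatSize-combine {op = op} size-op (leaf χ) T₂ = ≤-reflexive (begin-equality
  flatSize (mapLeaves (op χ) T₂)
    ≡⟨ flatSize-mapLeaves (suc (size χ)) (size-op χ) T₂ ⟩
  leaves T₂ * suc (size χ) + flatSize T₂
    ≡⟨ cong (leaves T₂ * suc (size χ) +_) (+-identityʳ _) ⟨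
  leaves T₂ * suc (size χ) + 1 * flatSize T₂ ∎)
  where open ≤-Reasoning
flatSize-combine {op = op} size-op (guard c T) T₂ = begin
  suc (size c + flatSize (combine op T T₂))
    ≤⟨ s≤s (+-monoʳ-≤ (size c) (flatSize-combine size-op T T₂)) ⟩
  suc (size c) + (l₂ * flatSize T + leaves T * flatSize T₂)
    ≤⟨ +-monoˡ-≤ _ (m≤n*m (suc (size c)) l₂ {{>-nonZero (leaves-pos T₂)}}) ⟩
  l₂ * suc (size c) + (l₂ * flatSize T + leaves T * flatSize T₂)
    ≡⟨ guard-eq l₂ (size c) (flatSize T) _ ⟩
  l₂ * suc (size c + flatSize T) + leaves T * flatSize T₂ ∎
  where
  open ≤-Reasoning
  l₂ = leaves T₂
  guard-eq : ∀ l c s t → l * suc c + (l * s + t) ≡ l * suc (c + s) + t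
  guard-eq = solve-∀
flatSize-combine {op = op} size-op (fork T U) T₂ = begin
  suc (flatSize (combine op T T₂) + flatSize (combine op U T₂))
    ≤⟨ s≤s (+-mono-≤ (flatSize-combine size-op T T₂) (flatSize-combine size-op U T₂)) ⟩
  1 + ((l₂ * flatSize T + leaves T * flatSize T₂) + (l₂ * flatSize U + leaves U * flatSize T₂))
    ≤⟨ +-monoˡ-≤ _ (leaves-pos T₂) ⟩
  l₂ + ((l₂ * flatSize T + leaves T * flatSize T₂) + (l₂ * flatSize U + leaves U * flatSize T₂))
    ≡⟨ fork-eq l₂ (flatSize T) (flatSize U) (leaves T) (leaves U) (flatSize T₂) ⟩
  l₂ * suc (flatSize T + flatSize U) + (leaves T + leaves U) * flatSize T₂ ∎
  where
  open ≤-Reasoning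
  l₂ = leaves T₂
  fork-eq : ∀ l s t x y u
          → l + ((l * s + x * u) + (l * t + y * u)) ≡ l * suc (s + t) + (x + y) * u
  fork-eq = solve-∀

flatSize-pos : (T : Cases n) → 1 ≤ flatSize T
flatSize-pos (leaf χ) = s≤s z≤n
flatSize-pos (guard c T) = s≤s z≤n
flatSize-pos (fork T U) = s≤s z≤n

record Bounded (T : Cases n) (s : ℕ) : Set where
  constructor bounded
  field
    leaves≤ : leaves T ≤ 3 ^ s
    flatSize≤ : flatSize T ≤ 3 ^ s * s

bounded-atomic : size χ ≡ 1 → Bounded (leaf χ) 1
bounded-atomic size≡1 = bounded (s≤s z≤n) (s≤s (≤-trans (≤-reflexive size≡1) (n≤1+n 1)))

3^n*n-mono : ∀ {s t} → s ≤ t → 3 ^ s * s ≤ 3 ^ t * t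
3^n*n-mono s≤t = *-mono-≤ (^-monoʳ-≤ 3 s≤t) s≤t

bounded-suc : ∀ {s} → Bounded T s → Bounded T (suc s)
bounded-suc {s = s} (bounded l f) =
  bounded (≤-trans l (m≤n*m (3 ^ s) 3)) (≤-trans f (*-mono-≤ (m≤n*m (3 ^ s) 3) (n≤1+n s)))

bounded-combine : ∀ {op a b} → (∀ a b → size (op a b) ≡ suc (size a + size b))
                → Bounded T₁ a → Bounded T₂ b → Bounded (combine op T₁ T₂) (a + b)
bounded-combine {T₁ = T₁} {T₂ = T₂} {op} {a} {b} size-op (bounded l₁ f₁) (bounded l₂ f₂) =
  bounded leaves-bound flatSize-bound
  where
  open ≤-Reasoning
  leaves-bound = begin
    leaves (combine op T₁ T₂) ≡⟨ leaves-combine op T₁ T₂ ⟩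
    leaves T₁ * leaves T₂     ≤⟨ *-mono-≤ l₁ l₂ ⟩
    3 ^ a * 3 ^ b             ≡⟨ ^-distribˡ-+-* 3 a b ⟨
    3 ^ (a + b)               ∎
  flatSize-bound = begin
    flatSize (combine op T₁ T₂)                        ≤⟨ flatSize-combine size-op T₁ T₂ ⟩
    leaves T₂ * flatSize T₁ + leaves T₁ * flatSize T₂  ≤⟨ +-mono-≤ (*-mono-≤ l₂ f₁) (*-mono-≤ l₁ f₂) ⟩
    3 ^ b * (3 ^ a * a) + 3 ^ a * (3 ^ b * b)          ≡⟨ product-eq (3 ^ a) (3 ^ b) a b ⟩
    3 ^ a * 3 ^ b * (a + b)                            ≡⟨ cong (_* (a + b)) (^-distribˡ-+-* 3 a b) ⟨
    3 ^ (a + b) * (a + b)                              ∎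
    where
    product-eq : ∀ x y a b → y * (x * a) + x * (y * b) ≡ x * y * (a + b)
    product-eq = solve-∀

bounded-𝐗 : ∀ {s} → Bounded T s → Bounded (mapLeaves 𝐗 T) (suc s)
bounded-𝐗 {T = T} {s} (bounded l f) =
  bounded (≤-trans (≤-reflexive (leaves-mapLeaves 𝐗 T)) (≤-trans l (m≤n*m _ 3))) (begin
    flatSize (mapLeaves 𝐗 T)   ≡⟨ flatSize-mapLeaves 1 (λ _ → refl) T ⟩
    leaves T * 1 + flatSize T  ≤⟨ +-mono-≤ (≤-trans (≤-reflexive (*-identityʳ _)) l) f ⟩
    3 ^ s + 3 ^ s * s          ≡⟨ *-suc (3 ^ s) s ⟨
    3 ^ s * suc s              ≤⟨ *-monoˡ-≤ (suc s) (m≤n*m (3 ^ s) 3) ⟩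
    3 ^ suc s * suc s          ∎)
  where open ≤-Reasoning

-- The equivalences for 𝐖 under 𝐆𝐅 and 𝐔 under 𝐅𝐆 add one case and four nodes to the guard x
-- and the split y; 1 ≤ y excludes s = 0, where the four nodes would not fit.
bounded-guarded : ∀ s {l x y} → 1 ≤ y → l ≤ 3 ^ s → x ≤ 3 ^ s * s → y ≤ 3 ^ s * s
                → suc l ≤ 3 ^ suc s × 4 + (x + y) ≤ 3 ^ suc s * suc s
bounded-guarded zero 1≤y _ _ y≤0 with () ← ≤-trans 1≤y y≤0
bounded-guarded (suc s) {l} {x} {y} _ l≤ x≤ y≤ = leaves-bound , flatSize-bound
  where
  open ≤-Reasoning
  z = 3 ^ suc s
  twice≤thrice : ∀ m → m + m ≤ 3 * m
  twice≤thrice m = +-monoʳ-≤ m (m≤m+n m _)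
  4≤3z : 4 ≤ 3 * z
  4≤3z = ≤-trans (m≤m+n 4 5) (^-monoʳ-≤ 3 {2} {suc (suc s)} (s≤s (s≤s z≤n)))
  leaves-bound = begin
    1 + l  ≤⟨ +-mono-≤ (m^n>0 3 (suc s)) l≤ ⟩
    z + z  ≤⟨ twice≤thrice z ⟩
    3 * z  ∎
  flatSize-bound = begin
    4 + (x + y)
      ≤⟨ +-mono-≤ 4≤3z (≤-trans (+-mono-≤ x≤ y≤) (twice≤thrice (z * suc s))) ⟩
    3 * z + 3 * (z * suc s)    ≡⟨ cong (3 * z +_) (*-assoc 3 z (suc s)) ⟨
    3 * z + 3 * z * suc s      ≡⟨ *-suc (3 * z) (suc s) ⟨
    3 * z * suc (suc s)        ∎

guard-size : ∀ {L s t} → (∀ χ → size (L χ) ≡ suc (size χ)) → s ≤ t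
           → Bounded T s → size (flatten L T) ≤ 3 ^ t * t
guard-size {T = T} size-L s≤t (bounded _ f) =
  ≤-trans (≤-reflexive (size-flatten size-L T)) (≤-trans f (3^n*n-mono s≤t))

casesGF-bounded : LimitFree φ → Bounded (casesGF φ) (size φ)
casesFG-bounded : LimitFree φ → Bounded (casesFG φ) (size φ)
casesGF-bounded tt = bounded-atomic refl
casesGF-bounded ff = bounded-atomic refl
casesGF-bounded (atom p) = bounded-atomic refl
casesGF-bounded (natom p) = bounded-atomic refl
casesGF-bounded (p ∧ₗ q) =
  bounded-suc (bounded-combine (λ _ _ → refl) (casesGF-bounded p) (casesGF-bounded q))
casesGF-bounded (p ∨ₗ q) =
  bounded-suc (bounded-combine (λ _ _ → refl) (casesGF-bounded p) (casesGF-bounded q))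
casesGF-bounded (𝐗 p) = bounded-𝐗 (casesGF-bounded p)
casesGF-bounded (p 𝐔 q) =
  bounded-suc (bounded-combine (λ _ _ → refl) (casesGF-bounded p) (casesGF-bounded q))
casesGF-bounded {φ = φ 𝐖 ψ} (p 𝐖 q) =
  let P = combine _𝐔_ (casesGF φ) (casesGF ψ)
      bounded l f = bounded-combine {op = _𝐔_} (λ _ _ → refl) (casesGF-bounded p) (casesGF-bounded q)
      (l′ , f′) = bounded-guarded (size φ + size ψ) (flatSize-pos P) l
                    (guard-size (λ _ → refl) (m≤m+n _ _) (casesFG-bounded p)) f
  in bounded l′ (≤-trans (≤-reflexive (flatSize-eq (size (flatten 𝐅𝐆 (casesFG φ))) _)) f′)
  where
  flatSize-eq : ∀ c s → suc (suc (c + 2) + s) ≡ 4 + (c + s)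
  flatSize-eq = solve-∀
casesFG-bounded tt = bounded-atomic refl
casesFG-bounded ff = bounded-atomic refl
casesFG-bounded (atom p) = bounded-atomic refl
casesFG-bounded (natom p) = bounded-atomic refl
casesFG-bounded (p ∧ₗ q) =
  bounded-suc (bounded-combine (λ _ _ → refl) (casesFG-bounded p) (casesFG-bounded q))
casesFG-bounded (p ∨ₗ q) =
  bounded-suc (bounded-combine (λ _ _ → refl) (casesFG-bounded p) (casesFG-bounded q))
casesFG-bounded (𝐗 p) = bounded-𝐗 (casesFG-bounded p)
casesFG-bounded (p 𝐖 q) =
  bounded-suc (bounded-combine (λ _ _ → refl) (casesFG-bounded p) (casesFG-bounded q))
casesFG-bounded {φ = φ 𝐔 ψ} (p 𝐔 q) =
  let bounded l f = bounded-combine {op = _𝐖_} (λ _ _ → refl) (casesFG-bounded p) (casesFG-bounded q)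
      P = combine _𝐖_ (casesFG φ) (casesFG ψ)
      (l′ , f′) = bounded-guarded (size φ + size ψ) (flatSize-pos P)
                    l (guard-size (λ _ → refl) (m≤n+m _ (size φ)) (casesGF-bounded q)) f
  in bounded l′ f′

small-normal-form : ∀ {P s} L → (∀ χ → size (L χ) ≡ suc (size χ)) → (∀ {w} → Monotone L w)
                  → (∀ {χ} → P χ → NormalForm (L χ))
                  → NormalCases P T → Bounded T s → Correct T φ → HasSmallNF (L φ) (3 ^ s * s)
small-normal-form {T = T} L size-L mono normal-L normal (bounded _ f) correct =
  flatten L T , flatten-normal normal-L normal , ≤-trans (≤-reflexive (size-flatten size-L T)) f ,
  flatten-≣ T mono correct

proposition5p11 : ExcludedMiddle 0ℓ → (n : ℕ) (φ : LTL n) → hasLimit φ ≡ false →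
    HasSmallNF (𝐆𝐅 φ) (3 ^ size φ * size φ) × HasSmallNF (𝐅𝐆 φ) (3 ^ size φ * size φ)
proposition5p11 em n φ noLimit =
  small-normal-form 𝐆𝐅 (λ _ → refl) 𝐆𝐅-mono 𝐆𝐅-normal
    (casesGF-normal lf) (casesGF-bounded lf) (casesGF-correct em lf) ,
  small-normal-form 𝐅𝐆 (λ _ → refl) 𝐅𝐆-mono 𝐅𝐆-normal
    (casesFG-normal lf) (casesFG-bounded lf) (casesFG-correct em lf)
  where
  lf = limitFree φ noLimit
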